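{- Let $\Sigma$ be a finite alphabet, let $S=\langle (s_1,t_1),(s_2,t_2),\ldots\rangle$ be a sequence of events with $s_i\in\Sigma$ and strictly increasing timestamps $t_1<t_2<\cdots$, and let $e=\langle \phi_1,\ldots,\phi_k\rangle$ be a serial episode with $\phi_i\in\Sigma$. Suppose the OccMap $OM(e)=[L_1,\ldots,L_k]$ with active-layer index $OM(e).\ell$ is maintained on the prefix $S(n)$ according to the list update strategy described in the context. If at some point $OM(e).\ell=k+1$ (i.e. the last list $L_k$ is non-empty), then there exist entries $x_1\in L_1,\ldots,x_k\in L_k$ (one from each list, so at least $k$ entries, no two from the same list) such that $\langle x_1,\ldots,x_k\rangle$ is an occurrence of $e$ in $S$.
   Context: A serial episode $e=\langle\phi_1,\ldots,\phi_k\rangle$ is a totally ordered list of events; $k=|e|$. An occurrence of $e$ in $S$ is a tuple of timestamps $\langle x_1,\ldots,x_k\rangle$ with $x_1<x_2<\cdots<x_k$ such that for each $i$, the event occurring in $S$ at timestamp $x_i$ is $\phi_i$. The OccMap $OM(e)$ consists of $k$ lists $L_1,\ldots,L_k$ of timestamps (list $L_i$ corresponds to the $i$-th symbol $\phi_i$; repeated symbols of $e$ get separate lists) together with an integer $OM(e).\ell$. List update strategy: initially all lists are empty and $OM(e).\ell=1$. When an event $(s,t)$ of $S$ arrives, for every $j\le \min(OM(e).\ell,k)$ (with $OM(e).\ell$ its value before this event) such that $\phi_j=s$, the timestamp $t$ is appended to the end of $L_j$; afterwards $OM(e).\ell$ is set to the smallest index $j$ with $L_j$ empty, or to $k+1$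 if no list is empty. (No entries are ever removed under this strategy.) -}

module Defs where

open import Data.Nat using (ℕ; zero; suc; _<_; _<ᵇ_)
open import Data.Fin using (Fin; toℕ)
open import Data.Fin.Properties using (_≟_)
open import Data.Bool using (Bool; true; false; _∧_; if_then_else_)
open import Data.List using (List; []; _∷_; _++_; [_]; foldl; map)
open import Data.Vec using (Vec; []; _∷_; lookup; tabulate; replicate)
open import Data.Product using (_×_; _,_; proj₁; proj₂)
open import Relation.Nullary.Decidable using (⌊_⌋)

Event : ℕ → Set
Event m = Fin m × ℕ

timestamps : ∀ {m} → List (Event m) → List ℕ
timestamps = map proj₂

-- OccMap for an episode of length k: k lists L_1..L_k and the index ℓ
-- (1-based, as in the paper; ℓ = k+1 means no list is empty).
record OccMap (k : ℕ) : Set where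
  constructor mkOM
  field
    lists : Vec (List ℕ) k
    ell   : ℕ
open OccMap public

firstEmpty : ∀ {k} → Vec (List ℕ) k → ℕ
firstEmpty [] = 1
firstEmpty ([] ∷ ls) = 1
firstEmpty ((_ ∷ _) ∷ ls) = suc (firstEmpty ls)

initOM : (k : ℕ) → OccMap k
initOM k = mkOM (replicate k []) 1

-- processing event (s , t): for every 1-based j ≤ min(ℓ,k) with φ_j = s,
-- append t to L_j (0-based index i corresponds to j = i+1, so j ≤ ℓ iff toℕ i < ℓ);
-- then set ℓ to the first empty index (or k+1).
stepOM : ∀ {m k} → Vec (Fin m) k → OccMap k → Event m → OccMap k
stepOM {k = k} e (mkOM ls l) (s , t) = mkOM newLists (firstEmpty newLists)
  where
  newLists : Vec (List ℕ) k
  newLists = tabulate λ i →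
    if (toℕ i <ᵇ l) ∧ ⌊ lookup e i ≟ s ⌋
    then lookup ls i ++ [ t ]
    else lookup ls i

runOM : ∀ {m k} → Vec (Fin m) k → List (Event m) → OccMap k
runOM {k = k} e S = foldl (stepOM e) (initOM k) S

module Submission where

-- Call a vector of lists L₁ … L_k *chained* when every entry t of L_{j+1} has a
-- strictly smaller entry in L_j.  The OccMap built on any prefix P of S satisfies
-- three invariants:
--   * soundness: every entry of L_i is the timestamp of an event φ_i of P;
--   * the lists are chained;
--   * ℓ is the (1-based) index of the first empty list, or k+1.
-- Chaining survives an update by (s , t) because t is appended to L_{j+1} only
-- when j+1 ≤ ℓ, i.e. when L_j is already non-empty, and every entry present so
-- far is smaller than the fresh timestamp t.  When ℓ = k+1 the list L_k is
-- non-empty, and walking back from one of its entries through the chain gives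
-- x₁ < … < x_k with x_i ∈ L_i; soundness places each (φ_i , x_i) in S.

open import Defs
open import Data.Bool using (Bool; true; false; T; _∧_; if_then_else_)
open import Data.Bool.Properties using (T-∧)
open import Data.Empty using (⊥; ⊥-elim)
open import Data.Fin using (Fin; toℕ; fromℕ) renaming (_<_ to _<ᶠ_; zero to fzero; suc to fsuc)
open import Data.Fin.Properties using (_≟_; toℕ<n)
open import Data.List using (List; []; _∷_; _++_; [_]; _∷ʳ_; take)
open import Data.List.Properties using (foldl-∷ʳ)
open import Data.List.Membership.Propositional using (_∈_)
open import Data.List.Membership.Propositional.Properties using (∈-++⁺ˡ; ∈-++⁺ʳ; ∈-++⁻)
open import Data.List.Relation.Unary.Any using (here)
open import Data.List.Relation.Unary.All as All using (All; []; _∷_)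
open import Data.List.Relation.Unary.All.Properties using (++⁻)
open import Data.List.Relation.Unary.AllPairs using (AllPairs; []; _∷_)
open import Data.List.Relation.Unary.AllPairs.Properties using (map⁻; take⁺)
open import Data.List.Relation.Unary.Linked using (Linked)
open import Data.List.Relation.Unary.Linked.Properties using (Linked⇒AllPairs)
open import Data.List.Relation.Binary.Sublist.Propositional using () renaming (lookup to ⊆-lookup)
open import Data.List.Relation.Binary.Sublist.Propositional.Properties using (take-⊆)
open import Data.List.Reverse using (Reverse; []; _∶_∶ʳ_; reverseView)
open import Data.Nat using (ℕ; suc; zero; _<_; _≤_; _<ᵇ_; z≤n; s≤s)
open import Data.Nat.Properties using (<ᵇ⇒<; <-trans; ≤-refl; <⇒≤; <-≤-trans)
open import Data.Product using (Σ; ∃; _×_; _,_; proj₂)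
open import Data.Sum using (_⊎_; inj₁; inj₂)
open import Data.Unit using (tt)
open import Data.Vec using (Vec; lookup; replicate) renaming ([] to []ᵥ; _∷_ to _∷ᵥ_)
open import Data.Vec.Properties using (lookup∘tabulate; lookup-replicate)
open import Function.Bundles using (Equivalence)
open import Relation.Nullary.Decidable using (⌊_⌋; toWitness)
open import Relation.Binary.PropositionalEquality using (_≡_; refl; sym; trans; cong; subst; subst₂)

allPairs-∷ʳ⁻ : ∀ {A : Set} {R : A → A → Set} (xs : List A) {y : A} →
  AllPairs R (xs ∷ʳ y) → AllPairs R xs × All (λ x → R x y) xs
allPairs-∷ʳ⁻ [] _ = [] , []
allPairs-∷ʳ⁻ (x ∷ xs) (x<rest ∷ rest) with ++⁻ xs x<rest | allPairs-∷ʳ⁻ xs rest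
... | x<xs , x<y ∷ [] | xs-inc , xs<y = (x<xs ∷ xs-inc) , (x<y ∷ xs<y)

Inhabited : List ℕ → Set
Inhabited L = ∃ λ y → y ∈ L

Chained : ∀ {k} → Vec (List ℕ) k → Set
Chained {k} ls = ∀ (i j : Fin k) → toℕ j ≡ suc (toℕ i) →
  ∀ {t} → t ∈ lookup ls j → ∃ λ y → y ∈ lookup ls i × y < t

chained-tail : ∀ {k} {L : List ℕ} {ls : Vec (List ℕ) k} → Chained (L ∷ᵥ ls) → Chained ls
chained-tail chain i j j≡1+i = chain (fsuc i) (fsuc j) (cong suc j≡1+i)

chained-head : ∀ {k} {L L′ : List ℕ} {ls : Vec (List ℕ) k} → Chained (L ∷ᵥ L′ ∷ᵥ ls) →
  ∀ {t} → t ∈ L′ → ∃ λ y → y ∈ L × y < t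
chained-head chain = chain fzero (fsuc fzero) refl

Selection : ∀ {k} → Vec (List ℕ) k → Set
Selection {k} ls = Σ (Fin k → ℕ) λ x →
  ((i : Fin k) → x i ∈ lookup ls i) × ((i j : Fin k) → i <ᶠ j → x i < x j)

-- A selection from L′ ∷ ls extends to L ∷ L′ ∷ ls by a predecessor in L of its
-- first entry, which lies below all its other entries.
extend : ∀ {k} {L L′ : List ℕ} {ls : Vec (List ℕ) k} →
  (∀ {t} → t ∈ L′ → ∃ λ y → y ∈ L × y < t) →
  Selection (L′ ∷ᵥ ls) → Selection (L ∷ᵥ L′ ∷ᵥ ls)
extend {k} {L} {L′} {ls} predecessor (x , x∈ls , x-inc) = x⁺ , x⁺∈ls , x⁺-inc
  where
  y : ℕ
  y with predecessor (x∈ls fzero)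
  ... | y , _ , _ = y

  y∈L : y ∈ L
  y∈L with predecessor (x∈ls fzero)
  ... | _ , y∈L , _ = y∈L

  y<x₀ : y < x fzero
  y<x₀ with predecessor (x∈ls fzero)
  ... | _ , _ , y<x₀ = y<x₀

  x₀-least : ∀ j → x fzero ≤ x j
  x₀-least fzero = ≤-refl
  x₀-least (fsuc j) = <⇒≤ (x-inc fzero (fsuc j) (s≤s z≤n))

  x⁺ : Fin (suc (suc k)) → ℕ
  x⁺ fzero = y
  x⁺ (fsuc i) = x i

  x⁺∈ls : ∀ i → x⁺ i ∈ lookup (L ∷ᵥ L′ ∷ᵥ ls) i
  x⁺∈ls fzero = y∈L
  x⁺∈ls (fsuc i) = x∈ls i

  x⁺-inc : ∀ i j → i <ᶠ j → x⁺ i < x⁺ j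
  x⁺-inc fzero (fsuc j) _ = <-≤-trans y<x₀ (x₀-least j)
  x⁺-inc (fsuc i) (fsuc j) (s≤s i<j) = x-inc i j i<j

select : ∀ {k} (ls : Vec (List ℕ) (suc k)) → Chained ls →
  Inhabited (lookup ls (fromℕ k)) → Selection ls
select (L ∷ᵥ []ᵥ) _ (t , t∈L) = (λ _ → t) , (λ { fzero → t∈L }) , (λ { fzero fzero () })
select (L ∷ᵥ L′ ∷ᵥ ls) chain last =
  extend (chained-head chain) (select (L′ ∷ᵥ ls) (chained-tail chain) last)

firstEmpty-inhabited : ∀ {k} (ls : Vec (List ℕ) k) (i : Fin k) →
  suc (toℕ i) < firstEmpty ls → Inhabited (lookup ls i)
firstEmpty-inhabited ([] ∷ᵥ ls) i (s≤s ())
firstEmpty-inhabited ((y ∷ _) ∷ᵥ ls) fzero _ = y , here refl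
firstEmpty-inhabited ((_ ∷ _) ∷ᵥ ls) (fsuc i) (s≤s 2+i≤) = firstEmpty-inhabited ls i 2+i≤

∈-if⁺ : ∀ {A : Set} (b : Bool) (xs : List A) (t : A) {u} →
  u ∈ xs → u ∈ (if b then xs ++ [ t ] else xs)
∈-if⁺ true xs t u∈xs = ∈-++⁺ˡ u∈xs
∈-if⁺ false xs t u∈xs = u∈xs

∈-if⁻ : ∀ {A : Set} (b : Bool) (xs : List A) (t : A) {u} →
  u ∈ (if b then xs ++ [ t ] else xs) → u ∈ xs ⊎ (T b × u ≡ t)
∈-if⁻ false xs t u∈xs = inj₁ u∈xs
∈-if⁻ true xs t u∈ with ∈-++⁻ xs u∈
... | inj₁ u∈xs = inj₁ u∈xs
... | inj₂ (here u≡t) = inj₂ (tt , u≡t)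

module Update {m k : ℕ} (e : Vec (Fin m) k) (om : OccMap k) (s : Fin m) (t : ℕ) where

  appends : Fin k → Bool
  appends i = (toℕ i <ᵇ ell om) ∧ ⌊ lookup e i ≟ s ⌋

  appends-sound : ∀ i → T (appends i) → toℕ i < ell om × lookup e i ≡ s
  appends-sound i app with Equivalence.to T-∧ app
  ... | i<ℓ , φ≡s = <ᵇ⇒< (toℕ i) (ell om) i<ℓ , toWitness φ≡s

  new : OccMap k
  new = stepOM e om (s , t)

  lookup-new : ∀ i → lookup (lists new) i ≡
    (if appends i then lookup (lists om) i ++ [ t ] else lookup (lists om) i)
  lookup-new i = lookup∘tabulate _ i

  ∈-new⁺ : ∀ i {u} → u ∈ lookup (lists om) i → u ∈ lookup (lists new) i
  ∈-new⁺ i u∈ = subst (_ ∈_) (sym (lookup-new i)) (∈-if⁺ (appends i) _ t u∈)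

  ∈-new⁻ : ∀ i {u} → u ∈ lookup (lists new) i →
    u ∈ lookup (lists om) i ⊎ ((toℕ i < ell om × lookup e i ≡ s) × u ≡ t)
  ∈-new⁻ i u∈ with ∈-if⁻ (appends i) _ t (subst (_ ∈_) (lookup-new i) u∈)
  ... | inj₁ u∈old = inj₁ u∈old
  ... | inj₂ (app , u≡t) = inj₂ (appends-sound i app , u≡t)

Sound : ∀ {m k} → Vec (Fin m) k → List (Event m) → Vec (List ℕ) k → Set
Sound {k = k} e P ls = ∀ (i : Fin k) {u} → u ∈ lookup ls i → (lookup e i , u) ∈ P

record Invariant {m k} (e : Vec (Fin m) k) (P : List (Event m)) (om : OccMap k) : Set where
  field
    sound      : Sound e P (lists om)
    chained    : Chained (lists om)
    ell-first  : ell om ≡ firstEmpty (lists om)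
open Invariant

initial-invariant : ∀ {m k} (e : Vec (Fin m) k) → Invariant e [] (initOM k)
initial-invariant {k = k} e = record
  { sound = λ i u∈ → ⊥-elim (nothing-initially i u∈)
  ; chained = λ _ j _ u∈ → ⊥-elim (nothing-initially j u∈)
  ; ell-first = sym (firstEmpty-replicate k) }
  where
  nothing-initially : ∀ i {u : ℕ} → u ∈ lookup (replicate k []) i → ⊥
  nothing-initially i u∈ with subst (_ ∈_) (lookup-replicate i []) u∈
  ... | ()

  firstEmpty-replicate : ∀ n → firstEmpty (replicate n ([] {A = ℕ})) ≡ 1
  firstEmpty-replicate zero = refl
  firstEmpty-replicate (suc n) = refl

step-invariant : ∀ {m k} (e : Vec (Fin m) k) (P : List (Event m)) (om : OccMap k) s t →
  Invariant e P om → All (λ a → proj₂ a < t) P →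
  Invariant e (P ∷ʳ (s , t)) (stepOM e om (s , t))
step-invariant e P om s t inv P<t = record
  { sound = sound′ ; chained = chained′ ; ell-first = refl }
  where
  open Update e om s t

  older : ∀ i {u} → u ∈ lookup (lists om) i → u < t
  older i u∈ = All.lookup P<t (sound inv i u∈)

  sound′ : Sound e (P ∷ʳ (s , t)) (lists new)
  sound′ i u∈ with ∈-new⁻ i u∈
  ... | inj₁ u∈old = ∈-++⁺ˡ (sound inv i u∈old)
  ... | inj₂ ((_ , refl) , refl) = ∈-++⁺ʳ P (here refl)

  -- A new entry t of L_j (j = i+1 ≤ ℓ) finds an older, hence smaller, entry in L_i.
  chained′ : Chained (lists new)
  chained′ i j j≡1+i u∈ with ∈-new⁻ j u∈
  ... | inj₁ u∈old =
    let (y , y∈ , y<u) = chained inv i j j≡1+i u∈old in y , ∈-new⁺ i y∈ , y<u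
  ... | inj₂ ((j<ℓ , _) , refl) =
    let (y , y∈) = firstEmpty-inhabited (lists om) i (subst₂ _<_ j≡1+i (ell-first inv) j<ℓ)
    in y , ∈-new⁺ i y∈ , older i y∈

Increasing : ∀ {m} → List (Event m) → Set
Increasing = AllPairs (λ a b → proj₂ a < proj₂ b)

invariant : ∀ {m k} (e : Vec (Fin m) k) {P : List (Event m)} →
  Reverse P → Increasing P → Invariant e P (runOM e P)
invariant e [] _ = initial-invariant e
invariant {k = k} e (P ∶ rev ∶ʳ (s , t)) inc
  rewrite foldl-∷ʳ (stepOM e) (initOM k) (s , t) P
  with allPairs-∷ʳ⁻ P inc
... | P-inc , P<t = step-invariant e P (runOM e P) s t (invariant e rev P-inc) P<t

theorem1 : ∀ {m k : ℕ} (S : List (Event m)) (e : Vec (Fin m) k) (n : ℕ) →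
    Linked _<_ (timestamps S) →
    ell (runOM e (take n S)) ≡ suc k →
    Σ (Fin k → ℕ) λ x →
      ((i : Fin k) → x i ∈ lookup (lists (runOM e (take n S))) i) ×
      ((i j : Fin k) → i <ᶠ j → x i < x j) ×
      ((i : Fin k) → (lookup e i , x i) ∈ S)
theorem1 {k = zero} _ _ _ _ _ = (λ ()) , (λ ()) , (λ ()) , (λ ())
theorem1 {k = suc k} S e n linked full =
  let (x , x∈ls , x-inc) = select ls (chained inv) last-inhabited
  in x , x∈ls , x-inc , λ i → ⊆-lookup (take-⊆ n S) (sound inv i (x∈ls i))
  where
  ls : Vec (List ℕ) (suc k)
  ls = lists (runOM e (take n S))

  inv : Invariant e (take n S) (runOM e (take n S))
  inv = invariant e (reverseView (take n S)) (take⁺ n (map⁻ (Linked⇒AllPairs <-trans linked)))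

  last-inhabited : Inhabited (lookup ls (fromℕ k))
  last-inhabited = firstEmpty-inhabited ls (fromℕ k)
    (subst (suc (toℕ (fromℕ k)) <_) (trans (sym full) (ell-first inv)) (s≤s (toℕ<n (fromℕ k))))
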